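{- Let $k$ be a positive integer and let $T_k=k(k+1)/2$. Let $R_k(n)$ be the number of partitions of $n$ whose Durfee triangle has size $k$, and $\mathcal{F}_k(q)=\sum_{n\ge 0}R_k(n)q^n$. For integers $d\ge1$ define the formal power series \[ A_d(q)=\sum_{k_1=0}^{\infty}\sum_{k_2=0}^{k_1+1}\cdots\sum_{k_d=0}^{k_{d-1}+1}q^{k_1+k_2+\cdots+k_d}, \] and set $A_0(q)=1$. Then \[ \mathcal{F}_k(q)=q^{T_k}\sum_{d=0}^{k}q^d A_d(q)A_{k-d}(q). \]
   Context: A partition of $n\ge 0$ is a tuple $\lambda=(\lambda_1,\dots,\lambda_d)$ of integers $\lambda_1\ge\cdots\ge\lambda_d\ge 1$ with sum $n$; set $\lambda_j=0$ for $j>d$. The Durfee triangle of $\lambda$ has size $k$ if $k$ is the largest integer such that $\lambda_j>k-j$ for all $j\in\{1,2,\dots,k\}$. -}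

module Defs where

open import Data.Nat using (ℕ; zero; suc; _+_; _*_; _∸_; _≤_; _<_; _⊔_; _≤?_; _<?_)
open import Data.Nat.DivMod using (_/_)
open import Data.Nat.ListAction using (sum)
open import Data.List using (List; []; _∷_; map; upTo; filter; foldr)
open import Data.List.Relation.Unary.All using (All; all?)
open import Data.List.Relation.Unary.Linked using (Linked)
open import Data.Product using (Σ; _×_)
open import Relation.Binary.PropositionalEquality using (_≡_)
open import Relation.Nullary using (Dec; yes; no)

-- λ_j for j ≥ 1 (1-indexed); λ_j = 0 for j > length
part : List ℕ → ℕ → ℕ
part []       _             = 0
part (x ∷ xs) zero          = 0   -- index 0 is never used
part (x ∷ xs) (suc zero)    = x
part (x ∷ xs) (suc (suc j)) = part xs (suc j)

IsPartition : ℕ → List ℕ → Set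
IsPartition n l = Linked (λ a b → b ≤ a) l × All (λ a → 1 ≤ a) l × sum l ≡ n

-- condition "λ_j > m - j for all j ∈ {1,…,m}"  (equivalently m < λ_j + j)
DurfeeOK : List ℕ → ℕ → Set
DurfeeOK l m = All (λ j → m < part l j + j) (map suc (upTo m))

durfeeOK? : ∀ l m → Dec (DurfeeOK l m)
durfeeOK? l m = all? (λ j → m <? part l j + j) (map suc (upTo m))

-- Durfee triangle size: the largest m with DurfeeOK l m.
-- Any m ≥ 1 with DurfeeOK l m satisfies m < λ_1 + 1, so it suffices to search m ∈ {0,…,λ_1}.
durfee : List ℕ → ℕ
durfee l = foldr _⊔_ 0 (filter (durfeeOK? l) (upTo (suc (part l 1))))

PartDurfee : ℕ → ℕ → Set
PartDurfee k n = Σ (List ℕ) (λ l → IsPartition n l × durfee l ≡ k)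

Series : Set
Series = ℕ → ℕ

sumTo : ℕ → (ℕ → ℕ) → ℕ
sumTo zero    f = f 0
sumTo (suc m) f = sumTo m f + f (suc m)

_⊛_ : Series → Series → Series
(f ⊛ g) m = sumTo m (λ i → f i * g (m ∸ i))

shift : ℕ → Series → Series
shift s f n with s ≤? n
... | yes _ = f (n ∸ s)
... | no  _ = 0

sumSeries : ℕ → (ℕ → Series) → Series
sumSeries k F n = sumTo k (λ d → F d n)

-- aux d b m = #{(k_1,…,k_d) ∈ ℕ^d : k_1 ≤ b, k_{i+1} ≤ k_i + 1, k_1+…+k_d = m}
aux : ℕ → ℕ → ℕ → ℕ
aux zero    b zero    = 1
aux zero    b (suc m) = 0
aux (suc d) b m = sumTo m (λ k → bounded k (k ≤? b))
  where
  bounded : (k : ℕ) → Dec (k ≤ b) → ℕ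
  bounded k (yes _) = aux d (suc k) (m ∸ k)
  bounded k (no  _) = 0

-- A_d(q) = Σ_{k_1 ≥ 0} Σ_{k_2=0}^{k_1+1} … Σ_{k_d=0}^{k_{d-1}+1} q^{k_1+…+k_d},  A_0 = 1.
-- Coefficient of q^m: k_1 ranges over 0..m (larger k_1 contribute nothing).
A : ℕ → Series
A d m = aux d m m

T : ℕ → ℕ
T k = (k * suc k) / 2

RHS : ℕ → Series
RHS k = shift (T k) (sumSeries k (λ d → shift d (A d ⊛ A (k ∸ d))))

-- Both sides are read as generating functions of weighted sets. A partition λ whose
-- Durfee triangle has size k splits uniquely as U ++ P, where U is the longest initial
-- run of rows with λ_j ≥ k + 2 − j, say of length d ≤ k, and the remaining rows P have
-- parts at most k − d and contain the staircase (k − d, …, 1). Removing the staircase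
-- (k + 1, …, k + 2 − d) from U, and the staircase (k − d, …, 1) from the conjugate of P,
-- leaves two sequences with k_{i+1} ≤ k_i + 1, which are what A_d and A_{k−d} count;
-- the T_k + d removed cells account for the factor q^{T_k + d}.
module Submission where

open import Defs
open import Data.Nat using (ℕ; _≤_)
open import Data.Fin using (Fin)
open import Function.Bundles using (_↔_)

open import Data.Nat using (zero; suc; _+_; _*_; _∸_; _≥_; _<_; _≤?_; _⊔_; _/_; z≤n; s≤s)
open import Data.Nat.Properties
open import Data.Nat.DivMod using (m*n/n≡m)
open import Data.Nat.ListAction using (sum)
open import Data.Nat.ListAction.Properties using (sum-++)
open import Data.Nat.Tactic.RingSolver using (solve-∀)
open import Algebra.Properties.CommutativeSemigroup +-commutativeSemigroup using (x∙yz≈y∙xz)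
import Data.Fin as Fin
open import Data.Fin.Properties using (+↔⊎; *↔×)
open import Data.List using (List; []; _∷_; _++_; head; length; upTo; foldr)
open import Data.List.Properties using (∷-injective; foldr-preservesᵇ; foldr-preservesᵒ)
open import Data.List.Membership.Propositional using (_∈_)
open import Data.List.Membership.Propositional.Properties using (∈-filter⁺; ∈-upTo⁺)
open import Data.List.Relation.Unary.All as All using (All; []; _∷_)
import Data.List.Relation.Unary.All.Properties as Allₚ
import Data.List.Relation.Unary.Any as Any
open import Data.List.Relation.Unary.Linked as Linked using (Linked; []; [-]; _∷_)
open import Data.List.Relation.Unary.Linked.Properties using (Linked⇒All)
open import Data.Maybe.Relation.Unary.All as Maybe using (just; nothing)
open import Data.Empty using (⊥; ⊥-elim)
open import Data.Unit using (⊤; tt)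
open import Data.Product using (Σ; _×_; _,_; proj₁; proj₂)
open import Data.Product.Function.Dependent.Propositional using (Σ-↔; congˡ)
open import Data.Product.Function.NonDependent.Propositional using (_×-↔_)
open import Data.Sum using (_⊎_; inj₁; inj₂; [_,_])
open import Data.Sum.Function.Propositional using (_⊎-↔_)
open import Function using (_∘_; flip)
open import Function.Bundles using (Inverse; mk↔ₛ′)
open import Function.Properties.Inverse using (↔-refl; ↔-trans)
open import Relation.Binary.PropositionalEquality
  using (_≡_; refl; sym; trans; cong; cong₂; subst; module ≡-Reasoning)
open import Relation.Nullary using (Irrelevant; ¬_; yes; no)
import Relation.Unary as U

irrelevant-↔ : {A B : Set} → Irrelevant A → Irrelevant B → (A → B) → (B → A) → A ↔ B
irrelevant-↔ A-irr B-irr f g = mk↔ₛ′ f g (λ _ → B-irr _ _) (λ _ → A-irr _ _)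

empty-↔ : {A B : Set} → ¬ A → ¬ B → A ↔ B
empty-↔ ¬a ¬b =
  irrelevant-↔ (λ a → ⊥-elim (¬a a)) (λ b → ⊥-elim (¬b b)) (⊥-elim ∘ ¬a) (⊥-elim ∘ ¬b)

×-irrelevant : {A B : Set} → Irrelevant A → Irrelevant B → Irrelevant (A × B)
×-irrelevant A-irr B-irr (a , b) (a′ , b′) = cong₂ _,_ (A-irr a a′) (B-irr b b′)

proj₁-injective : {A : Set} {P : A → Set} → U.Irrelevant P →
                  {x y : Σ A P} → proj₁ x ≡ proj₁ y → x ≡ y
proj₁-injective P-irr {_ , p} {_ , q} refl = cong (_ ,_) (P-irr p q)

subset-↔ : {A B : Set} {P : A → Set} {Q : B → Set} → U.Irrelevant P → U.Irrelevant Q →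
           (f : A → B) (g : B → A) → (∀ {a} → P a → Q (f a)) → (∀ {b} → Q b → P (g b)) →
           (∀ {b} → Q b → f (g b) ≡ b) → (∀ {a} → P a → g (f a) ≡ a) → Σ A P ↔ Σ B Q
subset-↔ P-irr Q-irr f g f-resp g-resp fg gf = mk↔ₛ′
  (λ (a , p) → f a , f-resp p) (λ (b , q) → g b , g-resp q)
  (λ (_ , q) → proj₁-injective Q-irr (fg q)) (λ (_ , p) → proj₁-injective P-irr (gf p))

-- Generating functions of weighted sets

GenFun : Series → {X : Set} → (X → ℕ) → Set
GenFun f {X} w = ∀ n → Fin (f n) ↔ Σ X (λ x → w x ≡ n)

genFun-↔ : {X Y : Set} {f : Series} {v : X → ℕ} {w : Y → ℕ} → GenFun f v →
           (e : X ↔ Y) → (∀ x → w (Inverse.to e x) ≡ v x) → GenFun f w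
genFun-↔ f-gf e w∘e≡v n = ↔-trans (f-gf n)
  (Σ-↔ e (irrelevant-↔ ≡-irrelevant ≡-irrelevant (trans (w∘e≡v _)) (trans (sym (w∘e≡v _)))))

Σ≤-suc-↔ : ∀ m (F : ℕ → Set) →
           (Σ ℕ (λ i → i ≤ m × F i) ⊎ F (suc m)) ↔ Σ ℕ (λ i → i ≤ suc m × F i)
Σ≤-suc-↔ m F = mk↔ₛ′ to from to∘from from∘to
  where
  to : Σ ℕ (λ i → i ≤ m × F i) ⊎ F (suc m) → Σ ℕ (λ i → i ≤ suc m × F i)
  to (inj₁ (i , i≤m , x)) = i , m≤n⇒m≤1+n i≤m , x
  to (inj₂ x)             = suc m , ≤-refl , x
  from : Σ ℕ (λ i → i ≤ suc m × F i) → Σ ℕ (λ i → i ≤ m × F i) ⊎ F (suc m)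
  from (i , i≤1+m , x) with m≤n⇒m<n∨m≡n i≤1+m
  ... | inj₁ i<1+m = inj₁ (i , m<1+n⇒m≤n i<1+m , x)
  ... | inj₂ refl  = inj₂ x
  to∘from : ∀ y → to (from y) ≡ y
  to∘from (i , i≤1+m , x) with m≤n⇒m<n∨m≡n i≤1+m
  ... | inj₁ _    = cong (λ p → i , p , x) (≤-irrelevant _ _)
  ... | inj₂ refl = cong (λ p → suc m , p , x) (≤-irrelevant _ _)
  from∘to : ∀ y → from (to y) ≡ y
  from∘to (inj₁ (i , i≤m , x)) with m≤n⇒m<n∨m≡n (m≤n⇒m≤1+n i≤m)
  ... | inj₁ _    = cong (λ p → inj₁ (i , p , x)) (≤-irrelevant _ _)
  ... | inj₂ refl = ⊥-elim (1+n≰n i≤m)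
  from∘to (inj₂ x) with m≤n⇒m<n∨m≡n (≤-refl {suc m})
  ... | inj₁ 1+m<1+m = ⊥-elim (<-irrefl refl 1+m<1+m)
  ... | inj₂ refl    = refl

Fin-sumTo-↔ : ∀ m (g : ℕ → ℕ) → Fin (sumTo m g) ↔ Σ ℕ (λ i → i ≤ m × Fin (g i))
Fin-sumTo-↔ zero    g = mk↔ₛ′ (λ x → 0 , z≤n , x) (λ { (_ , z≤n , x) → x })
                              (λ { (_ , z≤n , x) → refl }) (λ _ → refl)
Fin-sumTo-↔ (suc m) g =
  ↔-trans +↔⊎ (↔-trans (Fin-sumTo-↔ m g ⊎-↔ ↔-refl) (Σ≤-suc-↔ m (λ i → Fin (g i))))

shift-genFun : ∀ s {X : Set} {f : Series} {w : X → ℕ} →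
               GenFun f w → GenFun (shift s f) (λ x → s + w x)
shift-genFun s {w = w} f-gf n with s ≤? n
... | yes s≤n = ↔-trans (f-gf (n ∸ s)) (congˡ (irrelevant-↔ ≡-irrelevant ≡-irrelevant
                  (λ e → trans (cong (s +_) e) (m+[n∸m]≡n s≤n))
                  (λ e → trans (sym (m+n∸m≡n s _)) (cong (_∸ s) e))))
... | no  s≰n = empty-↔ (λ ()) (λ (x , e) → s≰n (subst (s ≤_) e (m≤m+n s (w x))))

convolution-genFun : {Y : ℕ → Set} {g : ℕ → Series} {w : ∀ i → Y i → ℕ} →
                     (∀ i → GenFun (g i) (w i)) →
                     GenFun (λ m → sumTo m (λ i → g i (m ∸ i))) (λ ((i , y) : Σ ℕ Y) → i + w i y)
convolution-genFun {Y} {w = w} g-gf m =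
  ↔-trans (Fin-sumTo-↔ m _)
    (↔-trans (congˡ (↔-refl ×-↔ g-gf _ _)) (mk↔ₛ′ to from to∘from from∘to))
  where
  to : Σ ℕ (λ i → i ≤ m × Σ (Y i) (λ y → w i y ≡ m ∸ i)) →
       Σ (Σ ℕ Y) (λ (i , y) → i + w i y ≡ m)
  to (i , i≤m , y , e) = (i , y) , trans (cong (i +_) e) (m+[n∸m]≡n i≤m)
  from : Σ (Σ ℕ Y) (λ (i , y) → i + w i y ≡ m) →
         Σ ℕ (λ i → i ≤ m × Σ (Y i) (λ y → w i y ≡ m ∸ i))
  from ((i , y) , e) =
    i , subst (i ≤_) e (m≤m+n i (w i y)) , y , trans (sym (m+n∸m≡n i (w i y))) (cong (_∸ i) e)
  to∘from : ∀ z → to (from z) ≡ z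
  to∘from _ = proj₁-injective ≡-irrelevant refl
  from∘to : ∀ z → from (to z) ≡ z
  from∘to (i , _ , y , _) = cong₂ (λ p q → i , p , y , q) (≤-irrelevant _ _) (≡-irrelevant _ _)

⊛-genFun : {X Y : Set} {f g : Series} {v : X → ℕ} {w : Y → ℕ} → GenFun f v → GenFun g w →
           GenFun (f ⊛ g) (λ (x , y) → v x + w y)
⊛-genFun {X} {Y} {f} {g} {v} {w} f-gf g-gf =
  genFun-↔ (convolution-genFun {g = λ i j → f i * g j}
                               (λ i j → ↔-trans *↔× (↔-trans (f-gf i ×-↔ g-gf j) assoc)))
           (mk↔ₛ′ (λ (_ , (x , _) , y) → x , y) (λ (x , y) → v x , (x , refl) , y)
                  (λ _ → refl) (λ { (_ , (_ , refl) , _) → refl }))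
           (λ { (_ , (_ , refl) , _) → refl })
  where
  assoc : ∀ {i j} → (Σ X (λ x → v x ≡ i) × Σ Y (λ y → w y ≡ j))
                  ↔ Σ (Σ X (λ x → v x ≡ i) × Y) (λ (_ , y) → w y ≡ j)
  assoc = mk↔ₛ′ (λ (x , y , e) → (x , y) , e) (λ ((x , y) , e) → x , y , e)
                (λ _ → refl) (λ _ → refl)

sumSeries-genFun : ∀ k {F : ℕ → Series} {X : ℕ → Set} {w : ∀ d → X d → ℕ} →
                   (∀ d → GenFun (F d) (w d)) →
                   GenFun (sumSeries k F) (λ ((d , _ , x) : Σ ℕ (λ d → d ≤ k × X d)) → w d x)
sumSeries-genFun k F-gf n =
  ↔-trans (Fin-sumTo-↔ k _) (↔-trans (congˡ (↔-refl ×-↔ F-gf _ n))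
    (mk↔ₛ′ (λ (d , d≤k , x , e) → (d , d≤k , x) , e) (λ ((d , d≤k , x) , e) → d , d≤k , x , e)
           (λ _ → refl) (λ _ → refl)))

-- Lifting sequences

HeadAtMost : ℕ → List ℕ → Set
HeadAtMost b xs = Maybe.All (_≤ b) (head xs)

-- the sequences (k_1, …, k_d) with k_{i+1} ≤ k_i + 1 summed over in A_d
Lifting : ℕ → List ℕ → Set
Lifting zero    []       = ⊤
Lifting (suc d) (x ∷ xs) = HeadAtMost (suc x) xs × Lifting d xs
Lifting _       _        = ⊥

Lifting-irrelevant : ∀ d → U.Irrelevant (Lifting d)
Lifting-irrelevant zero    {[]}    = λ _ _ → refl
Lifting-irrelevant (suc d) {_ ∷ _} = ×-irrelevant (Maybe.irrelevant ≤-irrelevant) (Lifting-irrelevant d)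

Lifting-length : ∀ d xs → Lifting d xs → length xs ≡ d
Lifting-length zero    []       _       = refl
Lifting-length (suc d) (_ ∷ xs) (_ , l) = cong suc (Lifting-length d xs l)

auxStep : ℕ → ℕ → ℕ → Series
auxStep d b x j with x ≤? b
... | yes _ = aux d (suc x) j
... | no  _ = 0

sumTo-cong : ∀ m {f g : ℕ → ℕ} → (∀ i → f i ≡ g i) → sumTo m f ≡ sumTo m g
sumTo-cong zero    f≗g = f≗g 0
sumTo-cong (suc m) f≗g = cong₂ _+_ (sumTo-cong m f≗g) (f≗g (suc m))

-- The left-hand side is the summand of `aux (suc d) b m`, which is local to `aux`
-- and cannot be named; it is solved from the use in `aux-suc`.
aux-summand : ∀ d b m x → _ ≡ auxStep d b x (m ∸ x)

aux-suc : ∀ d b m → aux (suc d) b m ≡ sumTo m (λ x → auxStep d b x (m ∸ x))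
aux-suc d b m = sumTo-cong m (aux-summand d b m)

aux-summand d b m x with x ≤? b
... | yes _ = refl
... | no  _ = refl

aux-genFun : ∀ d b →
  GenFun (aux d b) (λ ((xs , _) : Σ (List ℕ) (λ xs → HeadAtMost b xs × Lifting d xs)) → sum xs)
aux-genFun zero    b zero    = mk↔ₛ′ (λ _ → ([] , nothing , tt) , refl) (λ _ → Fin.zero)
  (λ { (([] , nothing , tt) , refl) → refl }) (λ { Fin.zero → refl ; (Fin.suc ()) })
aux-genFun zero    b (suc n) = empty-↔ (λ ()) (λ { (([] , _) , ()) })
aux-genFun (suc d) b n rewrite aux-suc d b n =
  genFun-↔ (convolution-genFun auxStep-genFun) cons-↔ (λ _ → refl) n
  where
  auxStep-genFun : ∀ x → GenFun (auxStep d b x)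
    (λ ((_ , xs , _) : x ≤ b × Σ (List ℕ) (λ xs → HeadAtMost (suc x) xs × Lifting d xs)) → sum xs)
  auxStep-genFun x j with x ≤? b
  ... | yes x≤b = ↔-trans (aux-genFun d (suc x) j)
                    (mk↔ₛ′ (λ (s , e) → (x≤b , s) , e) (λ ((_ , s) , e) → s , e)
                           (λ _ → cong (λ p → (p , _) , _) (≤-irrelevant _ _)) (λ _ → refl))
  ... | no  x≰b = empty-↔ (λ ()) (x≰b ∘ proj₁ ∘ proj₁)
  cons-↔ : Σ ℕ (λ x → x ≤ b × Σ (List ℕ) (λ xs → HeadAtMost (suc x) xs × Lifting d xs))
         ↔ Σ (List ℕ) (λ xs → HeadAtMost b xs × Lifting (suc d) xs)
  cons-↔ = mk↔ₛ′ (λ (x , x≤b , xs , h , l) → x ∷ xs , just x≤b , h , l)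
                 (λ { (x ∷ xs , just x≤b , h , l) → x , x≤b , xs , h , l })
                 (λ { (x ∷ xs , just x≤b , h , l) → refl }) (λ (x , x≤b , xs , h , l) → refl)

HeadAtMost-sum : ∀ xs → HeadAtMost (sum xs) xs
HeadAtMost-sum []       = nothing
HeadAtMost-sum (x ∷ xs) = just (m≤m+n x (sum xs))

A-genFun : ∀ d → GenFun (A d) (λ ((xs , _) : Σ (List ℕ) (Lifting d)) → sum xs)
A-genFun d n = ↔-trans (aux-genFun d n n)
  (mk↔ₛ′ (λ ((xs , _ , l) , e) → (xs , l) , e)
         (λ ((xs , l) , e) → (xs , subst (λ b → HeadAtMost b xs) e (HeadAtMost-sum xs) , l) , e)
         (λ _ → refl)
         (λ ((xs , _ , l) , e) → cong (λ h → (xs , h , l) , e) (Maybe.irrelevant ≤-irrelevant _ _)))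

-- Raising by a staircase

Stair : ℕ → ℕ → List ℕ → Set
Stair c zero    _        = ⊤
Stair c (suc m) []       = ⊥
Stair c (suc m) (x ∷ xs) = c + suc m ≤ x × Stair c m xs

Stair-irrelevant : ∀ c m → U.Irrelevant (Stair c m)
Stair-irrelevant c zero            = λ _ _ → refl
Stair-irrelevant c (suc m) {_ ∷ _} = ×-irrelevant ≤-irrelevant (Stair-irrelevant c m)

Stair-length : ∀ c m xs → Stair c m xs → m ≤ length xs
Stair-length c zero    xs       _        = z≤n
Stair-length c (suc m) (x ∷ xs) (_ , st) = s≤s (Stair-length c m xs st)

Stair-antitone : ∀ c xs {m n} → m ≤ n → Stair c n xs → Stair c m xs
Stair-antitone c xs       {zero}          _         _          = tt
Stair-antitone c (x ∷ xs) {suc m} {suc n} (s≤s m≤n) (n<x , st) =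
  ≤-trans (+-monoʳ-≤ c (s≤s m≤n)) n<x , Stair-antitone c xs m≤n st

StairRows : ℕ → ℕ → List ℕ → Set
StairRows c d U = length U ≡ d × Linked _≥_ U × Stair c d U

StairRows-irrelevant : ∀ c d → U.Irrelevant (StairRows c d)
StairRows-irrelevant c d =
  ×-irrelevant ≡-irrelevant (×-irrelevant (Linked.irrelevant ≤-irrelevant) (Stair-irrelevant c d))

triangular : ℕ → ℕ
triangular zero    = 0
triangular (suc n) = triangular n + suc n

raise : ℕ → List ℕ → List ℕ
raise c []       = []
raise c (x ∷ xs) = x + (c + suc (length xs)) ∷ raise c xs

lower : ℕ → List ℕ → List ℕ
lower c []      = []
lower c (u ∷ U) = u ∸ (c + suc (length U)) ∷ lower c U

length-raise : ∀ c xs → length (raise c xs) ≡ length xs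
length-raise c []       = refl
length-raise c (x ∷ xs) = cong suc (length-raise c xs)

length-lower : ∀ c U → length (lower c U) ≡ length U
length-lower c []      = refl
length-lower c (u ∷ U) = cong suc (length-lower c U)

lower-raise : ∀ c xs → lower c (raise c xs) ≡ xs
lower-raise c []       = refl
lower-raise c (x ∷ xs) rewrite length-raise c xs =
  cong₂ _∷_ (m+n∸n≡m x (c + suc (length xs))) (lower-raise c xs)

raise-lower : ∀ c U → Stair c (length U) U → raise c (lower c U) ≡ U
raise-lower c []      _         = refl
raise-lower c (u ∷ U) (le , st) rewrite length-lower c U = cong₂ _∷_ (m∸n+n≡m le) (raise-lower c U st)

Stair-raise : ∀ c xs → Stair c (length xs) (raise c xs)
Stair-raise c []       = tt
Stair-raise c (x ∷ xs) = m≤n+m (c + suc (length xs)) x , Stair-raise c xs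

≤suc⇒+≤+suc : ∀ a {x y} → y ≤ suc x → y + a ≤ x + suc a
≤suc⇒+≤+suc a {x} {y} y≤1+x = subst (y + a ≤_) (sym (+-suc x a)) (+-monoˡ-≤ a y≤1+x)

+≤+suc⇒≤suc : ∀ a {x y} → y + a ≤ x + suc a → y ≤ suc x
+≤+suc⇒≤suc a {x} {y} le = +-cancelʳ-≤ a y (suc x) (subst (y + a ≤_) (+-suc x a) le)

Lifting⇒Linked-raise : ∀ c d xs → Lifting d xs → Linked _≥_ (raise c xs)
Lifting⇒Linked-raise c zero    []           _                = []
Lifting⇒Linked-raise c (suc d) (x ∷ [])     _                = [-]
Lifting⇒Linked-raise c (suc d) (x ∷ y ∷ ys) (just y≤1+x , l) =
  subst (λ o → y + a ≤ x + o) (sym (+-suc c (suc (length ys)))) (≤suc⇒+≤+suc a y≤1+x)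
    ∷ Lifting⇒Linked-raise c d (y ∷ ys) l
  where a = c + suc (length ys)

Linked-raise⇒Lifting : ∀ c d xs → length xs ≡ d → Linked _≥_ (raise c xs) → Lifting d xs
Linked-raise⇒Lifting c zero    []           _    _        = tt
Linked-raise⇒Lifting c (suc d) (x ∷ [])     refl _        = nothing , tt
Linked-raise⇒Lifting c (suc d) (x ∷ y ∷ ys) refl (le ∷ l) =
  just (+≤+suc⇒≤suc a (subst (λ o → y + a ≤ x + o) (+-suc c (suc (length ys))) le))
    , Linked-raise⇒Lifting c d (y ∷ ys) refl l
  where a = c + suc (length ys)

raise-↔ : ∀ c d → Σ (List ℕ) (Lifting d) ↔ Σ (List ℕ) (StairRows c d)
raise-↔ c d = subset-↔ (Lifting-irrelevant d) (StairRows-irrelevant c d) (raise c) (lower c)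
  (λ {xs} → raise-StairRows xs) (λ {U} → lower-Lifting U)
  (λ {U} (len , _ , st) → raise-lower c U (subst (λ m → Stair c m U) (sym len) st))
  (λ {xs} _ → lower-raise c xs)
  where
  raise-StairRows : ∀ xs → Lifting d xs → StairRows c d (raise c xs)
  raise-StairRows xs l with refl ← Lifting-length d xs l =
    length-raise c xs , Lifting⇒Linked-raise c d xs l , Stair-raise c xs
  lower-Lifting : ∀ U → StairRows c d U → Lifting d (lower c U)
  lower-Lifting U (refl , lU , st) = Linked-raise⇒Lifting c (length U) (lower c U) (length-lower c U)
    (subst (Linked _≥_) (sym (raise-lower c U st)) lU)

sum-raise : ∀ c xs → sum (raise c xs) ≡ sum xs + (length xs * c + triangular (length xs))
sum-raise c []       = refl
sum-raise c (x ∷ xs) = begin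
  x + (c + suc n) + sum (raise c xs)                  ≡⟨ cong (x + (c + suc n) +_) (sum-raise c xs) ⟩
  x + (c + suc n) + (sum xs + (n * c + triangular n)) ≡⟨ rearrange x c n (sum xs) (triangular n) ⟩
  x + sum xs + (suc n * c + (triangular n + suc n))   ∎
  where
  open ≡-Reasoning
  n = length xs
  rearrange : ∀ x c n s t → x + (c + suc n) + (s + (n * c + t)) ≡ x + s + (suc n * c + (t + suc n))
  rearrange = solve-∀

-- Conjugation

Linked-∷ : ∀ {x P} → HeadAtMost x P → Linked _≥_ P → Linked _≥_ (x ∷ P)
Linked-∷ {P = []}    _         _  = [-]
Linked-∷ {P = _ ∷ _} (just le) lP = le ∷ lP

Linked-head : ∀ {x P} → Linked _≥_ (x ∷ P) → HeadAtMost x P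
Linked-head [-]      = nothing
Linked-head (le ∷ _) = just le

StairCols : ℕ → List ℕ → Set
StairCols e P = Linked _≥_ P × All (1 ≤_) P × All (_≤ e) P × Stair 0 e P

StairCols-irrelevant : ∀ e → U.Irrelevant (StairCols e)
StairCols-irrelevant e =
  ×-irrelevant (Linked.irrelevant ≤-irrelevant) (×-irrelevant (All.irrelevant ≤-irrelevant)
    (×-irrelevant (All.irrelevant ≤-irrelevant) (Stair-irrelevant 0 e)))

addColumn : ℕ → List ℕ → List ℕ
addColumn zero    P       = P
addColumn (suc h) []      = 1 ∷ addColumn h []
addColumn (suc h) (x ∷ P) = suc x ∷ addColumn h P

-- On a partition this removes the first column, since every row after one of length 1 has length 1.
removeColumn : List ℕ → List ℕ
removeColumn (suc (suc x) ∷ P) = suc x ∷ removeColumn P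
removeColumn _                 = []

length-addColumn : ∀ h P → length P ≤ h → length (addColumn h P) ≡ h
length-addColumn zero    []      _        = refl
length-addColumn (suc h) []      _        = cong suc (length-addColumn h [] z≤n)
length-addColumn (suc h) (x ∷ P) (s≤s le) = cong suc (length-addColumn h P le)

sum-addColumn : ∀ h P → length P ≤ h → sum (addColumn h P) ≡ h + sum P
sum-addColumn zero    []      _        = refl
sum-addColumn (suc h) []      _        = cong suc (sum-addColumn h [] z≤n)
sum-addColumn (suc h) (x ∷ P) (s≤s le) =
  cong suc (trans (cong (x +_) (sum-addColumn h P le)) (x∙yz≈y∙xz x h (sum P)))

length-removeColumn : ∀ P → length (removeColumn P) ≤ length P
length-removeColumn []                = z≤n
length-removeColumn (zero ∷ P)        = z≤n
length-removeColumn (suc zero ∷ P)    = z≤n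
length-removeColumn (suc (suc x) ∷ P) = s≤s (length-removeColumn P)

removeColumn-addColumn : ∀ h P → All (1 ≤_) P → length P ≤ h → removeColumn (addColumn h P) ≡ P
removeColumn-addColumn zero    []          _         _        = refl
removeColumn-addColumn (suc h) []          _         _        = refl
removeColumn-addColumn (suc h) (suc x ∷ P) (_ ∷ pos) (s≤s le) =
  cong (suc x ∷_) (removeColumn-addColumn h P pos le)

addColumn-ones : ∀ P → Linked _≥_ (1 ∷ P) → All (1 ≤_) P → addColumn (length P) [] ≡ P
addColumn-ones []                _             _         = refl
addColumn-ones (suc zero ∷ P)    (_ ∷ lP)      (_ ∷ pos) = cong (1 ∷_) (addColumn-ones P lP pos)
addColumn-ones (suc (suc x) ∷ P) (s≤s () ∷ _) _

addColumn-removeColumn : ∀ P → Linked _≥_ P → All (1 ≤_) P → addColumn (length P) (removeColumn P) ≡ P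
addColumn-removeColumn []                _  _         = refl
addColumn-removeColumn (suc zero ∷ P)    lP (_ ∷ pos) = cong (1 ∷_) (addColumn-ones P lP pos)
addColumn-removeColumn (suc (suc x) ∷ P) lP (_ ∷ pos) =
  cong (suc (suc x) ∷_) (addColumn-removeColumn P (Linked.tail lP) pos)

addColumn-head : ∀ h {x} P → HeadAtMost x P → HeadAtMost (suc x) (addColumn h P)
addColumn-head zero    []      _         = nothing
addColumn-head zero    (y ∷ P) (just le) = just (m≤n⇒m≤1+n le)
addColumn-head (suc h) []      _         = just (s≤s z≤n)
addColumn-head (suc h) (y ∷ P) (just le) = just (s≤s le)

Linked-addColumn : ∀ h P → Linked _≥_ P → length P ≤ h → Linked _≥_ (addColumn h P)
Linked-addColumn zero    P       lP _        = lP
Linked-addColumn (suc h) []      _  _        =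
  Linked-∷ (addColumn-head h [] nothing) (Linked-addColumn h [] [] z≤n)
Linked-addColumn (suc h) (x ∷ P) lP (s≤s le) =
  Linked-∷ (addColumn-head h P (Linked-head lP)) (Linked-addColumn h P (Linked.tail lP) le)

All-addColumn-pos : ∀ h P → All (1 ≤_) P → All (1 ≤_) (addColumn h P)
All-addColumn-pos zero    P       pos       = pos
All-addColumn-pos (suc h) []      _         = s≤s z≤n ∷ All-addColumn-pos h [] []
All-addColumn-pos (suc h) (x ∷ P) (_ ∷ pos) = s≤s z≤n ∷ All-addColumn-pos h P pos

All-addColumn-≤ : ∀ h e P → All (_≤ e) P → All (_≤ suc e) (addColumn h P)
All-addColumn-≤ zero    e P       P≤e         = All.map m≤n⇒m≤1+n P≤e
All-addColumn-≤ (suc h) e []      _           = s≤s z≤n ∷ All-addColumn-≤ h e [] []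
All-addColumn-≤ (suc h) e (x ∷ P) (x≤e ∷ P≤e) = s≤s x≤e ∷ All-addColumn-≤ h e P P≤e

Stair-addColumn : ∀ e h P → Stair 0 e P → e < h → Stair 0 (suc e) (addColumn h P)
Stair-addColumn zero    (suc h) []      _         _         = s≤s z≤n , tt
Stair-addColumn zero    (suc h) (x ∷ P) _         _         = s≤s z≤n , tt
Stair-addColumn (suc e) (suc h) (x ∷ P) (le , st) (s≤s e<h) = s≤s le , Stair-addColumn e h P st e<h

removeColumn-head : ∀ {x} P → HeadAtMost (suc x) P → HeadAtMost x (removeColumn P)
removeColumn-head []                _               = nothing
removeColumn-head (zero ∷ P)        _               = nothing
removeColumn-head (suc zero ∷ P)    _               = nothing
removeColumn-head (suc (suc y) ∷ P) (just (s≤s le)) = just le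

Linked-removeColumn : ∀ P → Linked _≥_ P → Linked _≥_ (removeColumn P)
Linked-removeColumn []                _  = []
Linked-removeColumn (zero ∷ P)        _  = []
Linked-removeColumn (suc zero ∷ P)    _  = []
Linked-removeColumn (suc (suc x) ∷ P) lP =
  Linked-∷ (removeColumn-head P (Linked-head lP)) (Linked-removeColumn P (Linked.tail lP))

All-removeColumn-pos : ∀ P → All (1 ≤_) (removeColumn P)
All-removeColumn-pos []                = []
All-removeColumn-pos (zero ∷ P)        = []
All-removeColumn-pos (suc zero ∷ P)    = []
All-removeColumn-pos (suc (suc x) ∷ P) = s≤s z≤n ∷ All-removeColumn-pos P

All-removeColumn-≤ : ∀ e P → All (_≤ suc e) P → All (_≤ e) (removeColumn P)
All-removeColumn-≤ e []                _              = []
All-removeColumn-≤ e (zero ∷ P)        _              = []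
All-removeColumn-≤ e (suc zero ∷ P)    _              = []
All-removeColumn-≤ e (suc (suc x) ∷ P) (s≤s le ∷ P≤e) = le ∷ All-removeColumn-≤ e P P≤e

Stair-removeColumn : ∀ e P → Stair 0 (suc e) P → Stair 0 e (removeColumn P)
Stair-removeColumn zero    P                 _             = tt
Stair-removeColumn (suc e) (suc (suc x) ∷ P) (s≤s le , st) = le , Stair-removeColumn e P st

rows : List ℕ → List ℕ
rows = foldr addColumn []

columns : ℕ → List ℕ → List ℕ
columns zero    P = []
columns (suc e) P = length P ∷ columns e (removeColumn P)

length-rows : ∀ h C → Linked _≥_ (h ∷ C) → length (rows C) ≤ h
length-rows h []      _         = z≤n
length-rows h (c ∷ C) (c≤h ∷ l) = subst (_≤ h) (sym (length-addColumn c (rows C) (length-rows c C l))) c≤h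

Linked-rows : ∀ C → Linked _≥_ C → Linked _≥_ (rows C)
Linked-rows []      _ = []
Linked-rows (h ∷ C) l = Linked-addColumn h (rows C) (Linked-rows C (Linked.tail l)) (length-rows h C l)

All-rows-pos : ∀ C → All (1 ≤_) (rows C)
All-rows-pos []      = []
All-rows-pos (h ∷ C) = All-addColumn-pos h (rows C) (All-rows-pos C)

All-rows-≤ : ∀ C → All (_≤ length C) (rows C)
All-rows-≤ []      = []
All-rows-≤ (h ∷ C) = All-addColumn-≤ h (length C) (rows C) (All-rows-≤ C)

Stair-rows : ∀ e C → Stair 0 e C → Stair 0 e (rows C)
Stair-rows zero    C       _         = tt
Stair-rows (suc e) (h ∷ C) (le , st) = Stair-addColumn e h (rows C) (Stair-rows e C st) le

sum-rows : ∀ C → Linked _≥_ C → sum (rows C) ≡ sum C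
sum-rows []      _ = refl
sum-rows (h ∷ C) l =
  trans (sum-addColumn h (rows C) (length-rows h C l)) (cong (h +_) (sum-rows C (Linked.tail l)))

length-columns : ∀ e P → length (columns e P) ≡ e
length-columns zero    P = refl
length-columns (suc e) P = cong suc (length-columns e (removeColumn P))

Linked-columns : ∀ e P → Linked _≥_ (columns e P)
Linked-columns zero          P = []
Linked-columns (suc zero)    P = [-]
Linked-columns (suc (suc e)) P = length-removeColumn P ∷ Linked-columns (suc e) (removeColumn P)

Stair-columns : ∀ e P → Stair 0 e P → Stair 0 e (columns e P)
Stair-columns zero    P _  = tt
Stair-columns (suc e) P st =
  Stair-length 0 (suc e) P st , Stair-columns e (removeColumn P) (Stair-removeColumn e P st)

rows-columns : ∀ e P → Linked _≥_ P → All (1 ≤_) P → All (_≤ e) P → rows (columns e P) ≡ P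
rows-columns zero    []      _  _         _         = refl
rows-columns zero    (x ∷ P) _  (1≤x ∷ _) (x≤0 ∷ _) = ⊥-elim (1+n≰n (≤-trans 1≤x x≤0))
rows-columns (suc e) P       lP pos       P≤e       = begin
  addColumn (length P) (rows (columns e (removeColumn P)))
    ≡⟨ cong (addColumn (length P)) (rows-columns e (removeColumn P) (Linked-removeColumn P lP)
                                      (All-removeColumn-pos P) (All-removeColumn-≤ e P P≤e)) ⟩
  addColumn (length P) (removeColumn P)
    ≡⟨ addColumn-removeColumn P lP pos ⟩
  P ∎
  where open ≡-Reasoning

columns-rows : ∀ C → Linked _≥_ C → columns (length C) (rows C) ≡ C
columns-rows []      _ = refl
columns-rows (h ∷ C) l = cong₂ _∷_ (length-addColumn h (rows C) len≤h) (begin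
  columns (length C) (removeColumn (addColumn h (rows C)))
    ≡⟨ cong (columns (length C)) (removeColumn-addColumn h (rows C) (All-rows-pos C) len≤h) ⟩
  columns (length C) (rows C)
    ≡⟨ columns-rows C (Linked.tail l) ⟩
  C ∎)
  where
  open ≡-Reasoning
  len≤h = length-rows h C l

conjugate-↔ : ∀ e → Σ (List ℕ) (StairRows 0 e) ↔ Σ (List ℕ) (StairCols e)
conjugate-↔ e = subset-↔ (StairRows-irrelevant 0 e) (StairCols-irrelevant e) rows (columns e)
  (λ {C} (len , l , st) → Linked-rows C l , All-rows-pos C ,
                          subst (λ n → All (_≤ n) (rows C)) len (All-rows-≤ C) , Stair-rows e C st)
  (λ {P} (_ , _ , _ , st) → length-columns e P , Linked-columns e P , Stair-columns e P st)
  (λ {P} (l , pos , P≤e , _) → rows-columns e P l pos P≤e)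
  (λ {C} (len , l , _) → subst (λ n → columns n (rows C) ≡ C) len (columns-rows C l))

-- Durfee triangles

Stair⇒part : ∀ m l → Stair 0 m l → ∀ {i} → i < m → m < part l (suc i) + suc i
Stair⇒part (suc m) (x ∷ xs) (m<x , _) {zero}  _         = subst (suc m <_) (sym (+-comm x 1)) (s≤s m<x)
Stair⇒part (suc m) (x ∷ xs) (_ , st)  {suc i} (s≤s i<m) =
  subst (suc m <_) (sym (+-suc (part xs (suc i)) (suc i))) (s≤s (Stair⇒part m xs st i<m))

part⇒Stair : ∀ m l → (∀ {i} → i < m → m < part l (suc i) + suc i) → Stair 0 m l
part⇒Stair zero    l        _ = tt
part⇒Stair (suc m) []       f with s≤s () ← f {zero} (s≤s z≤n)
part⇒Stair (suc m) (x ∷ xs) f =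
  ≤-pred (subst (suc m <_) (+-comm x 1) (f {zero} (s≤s z≤n))) ,
  part⇒Stair m xs (λ {i} i<m → ≤-pred (subst (suc m <_) (+-suc (part xs (suc i)) (suc i)) (f (s≤s i<m))))

DurfeeOK⇒Stair : ∀ l m → DurfeeOK l m → Stair 0 m l
DurfeeOK⇒Stair l m ok = part⇒Stair m l (Allₚ.applyUpTo⁻ (λ i → i) m (Allₚ.map⁻ ok))

Stair⇒DurfeeOK : ∀ l m → Stair 0 m l → DurfeeOK l m
Stair⇒DurfeeOK l m st = Allₚ.map⁺ (Allₚ.applyUpTo⁺₁ (λ i → i) m (Stair⇒part m l st))

durfee-Stair : ∀ l → Stair 0 (durfee l) l
durfee-Stair l = DurfeeOK⇒Stair l (durfee l)
  (foldr-preservesᵇ ⊔-preserves [] (Allₚ.all-filter (durfeeOK? l) (upTo (suc (part l 1)))))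
  where
  ⊔-preserves : ∀ {m n} → DurfeeOK l m → DurfeeOK l n → DurfeeOK l (m ⊔ n)
  ⊔-preserves {m} {n} okm okn with ⊔-sel m n
  ... | inj₁ m⊔n≡m = subst (DurfeeOK l) (sym m⊔n≡m) okm
  ... | inj₂ m⊔n≡n = subst (DurfeeOK l) (sym m⊔n≡n) okn

∈⇒≤foldr-⊔ : ∀ {m} L → m ∈ L → m ≤ foldr _⊔_ 0 L
∈⇒≤foldr-⊔ L m∈L =
  foldr-preservesᵒ (λ a b → [ m≤n⇒m≤n⊔o b , m≤n⇒m≤o⊔n a ]) 0 L
                   (inj₂ (Any.map ≤-reflexive m∈L))

Stair⇒≤durfee : ∀ m l → Stair 0 m l → m ≤ durfee l
Stair⇒≤durfee zero    l        _              = z≤n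
Stair⇒≤durfee (suc m) (x ∷ xs) st@(m<x , _) =
  ∈⇒≤foldr-⊔ _ (∈-filter⁺ (durfeeOK? (x ∷ xs)) (∈-upTo⁺ (s≤s m<x))
                          (Stair⇒DurfeeOK (x ∷ xs) (suc m) st))

Stair⇒durfee≡ : ∀ k l → Stair 0 k l → ¬ Stair 0 (suc k) l → durfee l ≡ k
Stair⇒durfee≡ k l st ¬st =
  ≤-antisym (≮⇒≥ (λ k<d → ¬st (Stair-antitone 0 l k<d (durfee-Stair l)))) (Stair⇒≤durfee k l st)

durfee≡⇒Stair : ∀ k l → durfee l ≡ k → Stair 0 k l × ¬ Stair 0 (suc k) l
durfee≡⇒Stair k l refl = durfee-Stair l , λ st → 1+n≰n (Stair⇒≤durfee (suc (durfee l)) l st)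

HeadAtMost-++ˡ : ∀ {x} U P → HeadAtMost x (U ++ P) → HeadAtMost x U
HeadAtMost-++ˡ []      P _ = nothing
HeadAtMost-++ˡ (u ∷ U) P h = h

Linked-++ : ∀ {b} U P → Linked _≥_ U → All (b ≤_) U → HeadAtMost b P → Linked _≥_ P →
            Linked _≥_ (U ++ P)
Linked-++ []          P _  _         hP lP = lP
Linked-++ (u ∷ [])    P _  (b≤u ∷ _) hP lP = Linked-∷ (Maybe.map (λ p≤b → ≤-trans p≤b b≤u) hP) lP
Linked-++ (u ∷ v ∷ U) P lU (_ ∷ bU)  hP lP = Linked.head lU ∷ Linked-++ (v ∷ U) P (Linked.tail lU) bU hP lP

Stair⇒All≥ : ∀ c U → Stair c (length U) U → All (c ≤_) U
Stair⇒All≥ c []      _         = []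
Stair⇒All≥ c (u ∷ U) (le , st) = ≤-trans (m≤m+n c _) le ∷ Stair⇒All≥ c U st

Stair-++ : ∀ {c c′ e} U P → Stair c (length U) U → Stair c′ e P → c′ + e ≤ c →
           Stair c′ (length U + e) (U ++ P)
Stair-++                []      P _          stP _     = stP
Stair-++ {c} {c′} {e} (u ∷ U) P (le , stU) stP bound =
  ≤-trans (≤-reflexive (rearrange c′ e (length U))) (≤-trans (+-monoˡ-≤ (suc (length U)) bound) le) ,
  Stair-++ U P stU stP bound
  where
  rearrange : ∀ c′ e n → c′ + suc (n + e) ≡ c′ + e + suc n
  rearrange = solve-∀

Stair-drop : ∀ {c m} U P → Stair c (length U + m) (U ++ P) → Stair c m P
Stair-drop []      P st       = st
Stair-drop (u ∷ U) P (_ , st) = Stair-drop U P st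

All≤⇒¬Stair : ∀ e P → All (_≤ e) P → ¬ Stair 0 (suc e) P
All≤⇒¬Stair e (p ∷ P) (p≤e ∷ _) (e<p , _) = 1+n≰n (≤-trans e<p p≤e)

suc[k∸d]+d≡suc[k] : ∀ {k d} → d ≤ k → suc (k ∸ d) + d ≡ suc k
suc[k∸d]+d≡suc[k] d≤k = cong suc (m∸n+n≡m d≤k)

DurfeeSplit : ℕ → List ℕ → Set
DurfeeSplit k l = Σ ℕ λ d → d ≤ k × Σ (List ℕ) λ U → Σ (List ℕ) λ P →
                  (StairRows (suc (k ∸ d)) d U × StairCols (k ∸ d) P) × l ≡ U ++ P

durfeeSplit : ∀ k l → Linked _≥_ l → All (1 ≤_) l → Stair 0 k l → ¬ Stair 0 (suc k) l →
              DurfeeSplit k l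
durfeeSplit zero    []       _  _   _  _   = 0 , z≤n , [] , [] , ((refl , [] , tt) , ([] , [] , [] , tt)) , refl
durfeeSplit k       (x ∷ xs) lx pos st ¬st with suc k ≤? x
durfeeSplit zero    (x ∷ xs) lx pos st ¬st | yes k<x = ⊥-elim (¬st (k<x , tt))
durfeeSplit (suc k) (x ∷ xs) lx pos st ¬st | yes k<x
  with d , d≤k , U , P , ((len , lU , stU) , stP) , refl
         ← durfeeSplit k xs (Linked.tail lx) (All.tail pos) (proj₂ st) (λ st′ → ¬st (k<x , st′))
  = suc d , s≤s d≤k , x ∷ U , P ,
    ((cong suc len , Linked-∷ (HeadAtMost-++ˡ U P (Linked-head lx)) lU ,
      (subst (_≤ x) (sym (trans (+-suc (suc (k ∸ d)) d) (cong suc (suc[k∸d]+d≡suc[k] d≤k)))) k<x ,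
       stU)) , stP) ,
    refl
durfeeSplit k       (x ∷ xs) lx pos st ¬st | no  x≰k =
  0 , z≤n , [] , x ∷ xs ,
  ((refl , [] , tt) , (lx , pos , Linked⇒All (flip ≤-trans) (≤-pred (≰⇒> x≰k)) lx , st)) , refl

StairRows-head : ∀ {k d u U} → d ≤ k → StairRows (suc (k ∸ d)) d (u ∷ U) → k < u
StairRows-head {u = u} d≤k (refl , _ , le , _) = subst (_≤ u) (suc[k∸d]+d≡suc[k] d≤k) le

DurfeeSplit-unique : ∀ k {d d′ U U′ P P′} → d ≤ k → d′ ≤ k →
                     StairRows (suc (k ∸ d)) d U → StairCols (k ∸ d) P →
                     StairRows (suc (k ∸ d′)) d′ U′ → StairCols (k ∸ d′) P′ →
                     U ++ P ≡ U′ ++ P′ → U ≡ U′ × P ≡ P′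
DurfeeSplit-unique k {U = []}    {[]}    _   _    _          _                      _  _ eq   = refl , eq
DurfeeSplit-unique k {U = []}    {_ ∷ _} _   d′≤k (refl , _) (_ , _ , u′≤k ∷ _ , _) r′ _ refl =
  ⊥-elim (<⇒≱ (StairRows-head d′≤k r′) u′≤k)
DurfeeSplit-unique k {U = _ ∷ _} {[]}    d≤k _    r          _ (refl , _) (_ , _ , u≤k ∷ _ , _) refl =
  ⊥-elim (<⇒≱ (StairRows-head d≤k r) u≤k)
DurfeeSplit-unique _ {U = u ∷ U} {u′ ∷ U′} (s≤s d≤k) (s≤s d′≤k)
                   (refl , lU , _ , stU) c (refl , lU′ , _ , stU′) c′ eq
  with refl , eq′ ← ∷-injective eq
  with refl , refl ← DurfeeSplit-unique _ d≤k d′≤k (refl , Linked.tail lU , stU) c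
                                                   (refl , Linked.tail lU′ , stU′) c′ eq′
  = refl , refl

DurfeePieces : ℕ → Set
DurfeePieces k =
  Σ ℕ λ d → d ≤ k × (Σ (List ℕ) (StairRows (suc (k ∸ d)) d) × Σ (List ℕ) (StairCols (k ∸ d)))

DurfeePartition : ℕ → Set
DurfeePartition k = Σ (List ℕ) λ l → (Linked _≥_ l × All (1 ≤_) l) × durfee l ≡ k

glue : ∀ k → DurfeePieces k → DurfeePartition k
glue k (d , d≤k , (U , len , lU , stU) , (P , lP , posP , P≤e , stP)) =
  U ++ P ,
  (Linked-++ U P lU U≥ (HeadAtMost-suc P P≤e) lP , Allₚ.++⁺ (All.map (≤-trans (s≤s z≤n)) U≥) posP) ,
  Stair⇒durfee≡ k (U ++ P)
    (subst (λ m → Stair 0 m (U ++ P)) (trans (cong (_+ (k ∸ d)) len) (m+[n∸m]≡n d≤k))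
           (Stair-++ U P stU′ stP (n≤1+n (k ∸ d))))
    (λ st → All≤⇒¬Stair (k ∸ d) P P≤e
              (Stair-drop U P (subst (λ m → Stair 0 m (U ++ P)) (sym length+suc[k∸d]) st)))
  where
  stU′ : Stair (suc (k ∸ d)) (length U) U
  stU′ = subst (λ m → Stair _ m U) (sym len) stU
  U≥ : All (suc (k ∸ d) ≤_) U
  U≥ = Stair⇒All≥ _ U stU′
  HeadAtMost-suc : ∀ P → All (_≤ k ∸ d) P → HeadAtMost (suc (k ∸ d)) P
  HeadAtMost-suc []      _         = nothing
  HeadAtMost-suc (p ∷ P) (p≤e ∷ _) = just (m≤n⇒m≤1+n p≤e)
  length+suc[k∸d] : length U + suc (k ∸ d) ≡ suc k
  length+suc[k∸d] =
    trans (+-suc (length U) (k ∸ d)) (cong suc (trans (cong (_+ (k ∸ d)) len) (m+[n∸m]≡n d≤k)))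

glue-↔ : ∀ k → DurfeePieces k ↔ DurfeePartition k
glue-↔ k = mk↔ₛ′ (glue k) (unglue ∘ split)
                 (λ x → glue∘unglue x (split x)) (λ x → unglue∘glue x (split (glue k x)))
  where
  split : (x : DurfeePartition k) → DurfeeSplit k (proj₁ x)
  split (l , (lP , pos) , dl) = let st , ¬st = durfee≡⇒Stair k l dl in durfeeSplit k l lP pos st ¬st
  unglue : ∀ {l} → DurfeeSplit k l → DurfeePieces k
  unglue (d , d≤k , U , P , (r , c) , _) = d , d≤k , (U , r) , (P , c)
  glue∘unglue : ∀ x (s : DurfeeSplit k (proj₁ x)) → glue k (unglue s) ≡ x
  glue∘unglue _ (_ , _ , _ , _ , _ , refl) = proj₁-injective
    (×-irrelevant (×-irrelevant (Linked.irrelevant ≤-irrelevant) (All.irrelevant ≤-irrelevant)) ≡-irrelevant)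
    refl
  unglue∘glue : ∀ x (s : DurfeeSplit k (proj₁ (glue k x))) → unglue s ≡ x
  unglue∘glue (d , d≤k , (U , r) , (P , c)) (d′ , d′≤k , U′ , P′ , (r′ , c′) , eq)
    with refl , refl ← DurfeeSplit-unique k d≤k d′≤k r c r′ c′ eq
    with refl ← trans (sym (proj₁ r)) (proj₁ r′)
    = cong₂ (λ p q → d , p , q) (≤-irrelevant d′≤k d≤k)
        (cong₂ (λ a b → (U , a) , (P , b)) (StairRows-irrelevant _ d r′ r) (StairCols-irrelevant _ c′ c))

triangular-+ : ∀ d e → triangular (d + e) ≡ triangular d + triangular e + d * e
triangular-+ zero    e = sym (+-identityʳ (triangular e))
triangular-+ (suc d) e = begin
  triangular (d + e) + suc (d + e)                  ≡⟨ cong (_+ suc (d + e)) (triangular-+ d e) ⟩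
  triangular d + triangular e + d * e + suc (d + e) ≡⟨ rearrange (triangular d) (triangular e) d e ⟩
  triangular d + suc d + triangular e + (e + d * e) ∎
  where
  open ≡-Reasoning
  rearrange : ∀ s t d e → s + t + d * e + suc (d + e) ≡ s + suc d + t + (e + d * e)
  rearrange = solve-∀

T≡triangular : ∀ k → T k ≡ triangular k
T≡triangular k = trans (cong (_/ 2) (sym (double k))) (m*n/n≡m (triangular k) 2)
  where
  double : ∀ k → triangular k * 2 ≡ k * suc k
  double zero    = refl
  double (suc k) = begin
    (triangular k + suc k) * 2   ≡⟨ *-distribʳ-+ 2 (triangular k) (suc k) ⟩
    triangular k * 2 + suc k * 2 ≡⟨ cong (_+ suc k * 2) (double k) ⟩
    k * suc k + suc k * 2        ≡⟨ rearrange k ⟩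
    suc k * suc (suc k)          ∎
    where
    open ≡-Reasoning
    rearrange : ∀ k → k * suc k + suc k * 2 ≡ suc k * suc (suc k)
    rearrange = solve-∀

Liftings : ℕ → Set
Liftings k = Σ ℕ λ d → d ≤ k × (Σ (List ℕ) (Lifting d) × Σ (List ℕ) (Lifting (k ∸ d)))

Liftings-weight : ∀ k → Liftings k → ℕ
Liftings-weight k (d , _ , (xs , _) , (ys , _)) = T k + (d + (sum xs + sum ys))

DurfeePieces-weight : ∀ k → DurfeePieces k → ℕ
DurfeePieces-weight k (_ , _ , (U , _) , (P , _)) = sum U + sum P

RHS-genFun : ∀ k → GenFun (RHS k) (Liftings-weight k)
RHS-genFun k =
  shift-genFun (T k) (sumSeries-genFun k (λ d → shift-genFun d (⊛-genFun (A-genFun d) (A-genFun (k ∸ d)))))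

Liftings-↔ : ∀ k → Liftings k ↔ DurfeePieces k
Liftings-↔ k =
  congˡ (λ {d} → ↔-refl ×-↔
                 (raise-↔ (suc (k ∸ d)) d ×-↔ ↔-trans (raise-↔ 0 (k ∸ d)) (conjugate-↔ (k ∸ d))))

Liftings-↔-weight : ∀ k x → DurfeePieces-weight k (Inverse.to (Liftings-↔ k) x) ≡ Liftings-weight k x
Liftings-↔-weight k (d , d≤k , (xs , lx) , (ys , ly)) = begin
  sum (raise (suc e) xs) + sum (rows (raise 0 ys))
    ≡⟨ cong (sum (raise (suc e) xs) +_) (sum-rows (raise 0 ys) (Lifting⇒Linked-raise 0 e ys ly)) ⟩
  sum (raise (suc e) xs) + sum (raise 0 ys)
    ≡⟨ cong₂ _+_ (sum-raise (suc e) xs) (sum-raise 0 ys) ⟩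
  sum xs + (length xs * suc e + triangular (length xs)) + (sum ys + (length ys * 0 + triangular (length ys)))
    ≡⟨ cong₂ (λ a b → sum xs + (a * suc e + triangular a) + (sum ys + (b * 0 + triangular b)))
             (Lifting-length d xs lx) (Lifting-length e ys ly) ⟩
  sum xs + (d * suc e + triangular d) + (sum ys + (e * 0 + triangular e))
    ≡⟨ rearrange d e (sum xs) (sum ys) (triangular d) (triangular e) ⟩
  triangular d + triangular e + d * e + (d + (sum xs + sum ys))
    ≡⟨ cong (_+ (d + (sum xs + sum ys))) (sym (triangular-+ d e)) ⟩
  triangular (d + e) + (d + (sum xs + sum ys))
    ≡⟨ cong (λ m → triangular m + (d + (sum xs + sum ys))) (m+[n∸m]≡n d≤k) ⟩
  triangular k + (d + (sum xs + sum ys))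
    ≡⟨ cong (_+ (d + (sum xs + sum ys))) (sym (T≡triangular k)) ⟩
  T k + (d + (sum xs + sum ys)) ∎
  where
  open ≡-Reasoning
  e = k ∸ d
  rearrange : ∀ d e x y s t → x + (d * suc e + s) + (y + (e * 0 + t)) ≡ s + t + d * e + (d + (x + y))
  rearrange = solve-∀

DurfeePartition-genFun : ∀ k → GenFun (RHS k) (λ (x : DurfeePartition k) → sum (proj₁ x))
DurfeePartition-genFun k =
  genFun-↔ (genFun-↔ (RHS-genFun k) (Liftings-↔ k) (Liftings-↔-weight k))
           (glue-↔ k) (λ (_ , _ , (U , _) , (P , _)) → sum-++ U P)

lemma1 : (k : ℕ) → 1 ≤ k → (n : ℕ) → Fin (RHS k n) ↔ PartDurfee k n
lemma1 k _ n = ↔-trans (DurfeePartition-genFun k n)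
  (mk↔ₛ′ (λ ((l , (lP , pos) , dl) , s) → l , (lP , pos , s) , dl)
         (λ (l , (lP , pos , s) , dl) → (l , (lP , pos) , dl) , s)
         (λ _ → refl) (λ _ → refl))
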